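{- Let $H$ be a connected proper interval graph, $S$ a minimal separator of $H$, and let $A_1,A_2$ be the nuclei of $S$ with respect to the two connected components of $H-S$. Then there is an ordering $s_1,\dots,s_m$ of the vertices of $S$ such that $N_{A_1}(s_1)\supseteq N_{A_1}(s_2)\supseteq\dots\supseteq N_{A_1}(s_m)$ and $N_{A_2}(s_1)\subseteq N_{A_2}(s_2)\subseteq\dots\subseteq N_{A_2}(s_m)$.
   Context: A proper interval graph is an intersection graph of intervals of the real line none properly containing another. For nonadjacent vertices $u,v$, $S$ is a $u,v$-minimal separator if $u,v$ lie in distinct connected components of $H-S$ and $S$ is inclusion-minimal with this property; a minimal separator is a $u,v$-minimal separator for some $u,v$. For a connected proper interval graph, $H-S$ has exactly two connected components for every minimal separator $S$. For a minimal separator $S$ and a connected component $C$ of $H-S$, the nucleus of $S$ with respect to $C$ is the set of vertices of $C$ with at least one neighbour in $S$. For $X\subseteq V$, $N_X(w)$ is the set of neighbours of $w$ in $X$. -}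

module Defs where

open import Data.Nat using (ℕ; _≤_; _<_)
open import Data.Fin using (Fin)
open import Data.Fin.Subset using (Subset; _∈_; _∉_; _⊆_; ∁; ⊤)
open import Data.Bool using (Bool; true; false)
open import Data.Product using (Σ; ∃; _×_; _,_)
open import Data.Sum using (_⊎_)
open import Relation.Nullary using (¬_)
open import Relation.Binary.PropositionalEquality using (_≡_; _≢_)

record Graph (n : ℕ) : Set where
  field
    adj    : Fin n → Fin n → Bool
    sym    : ∀ u v → adj u v ≡ adj v u
    irrefl : ∀ u → adj u u ≡ false

open Graph public

Adj : ∀ {n} → Graph n → Fin n → Fin n → Set
Adj G u v = adj G u v ≡ true

ProperlyContains : ∀ {n} (l r : Fin n → ℕ) → Fin n → Fin n → Set
ProperlyContains l r u v = l u ≤ l v × r v ≤ r u × (l u < l v ⊎ r v < r u)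

-- Proper interval graph: intersection graph of closed intervals (integer
-- endpoints suffice for finite graphs), none properly containing another.
ProperInterval : ∀ {n} → Graph n → Set
ProperInterval {n} G =
  Σ (Fin n → ℕ) λ l → Σ (Fin n → ℕ) λ r →
    (∀ v → l v ≤ r v) ×
    (∀ u v → u ≢ v →
       (Adj G u v → (l u ≤ r v × l v ≤ r u)) ×
       ((l u ≤ r v × l v ≤ r u) → Adj G u v)) ×
    (∀ u v → ¬ ProperlyContains l r u v)

data Reach {n} (G : Graph n) (X : Subset n) : Fin n → Fin n → Set where
  here : ∀ {u} → u ∈ X → Reach G X u u
  step : ∀ {u w v} → u ∈ X → Adj G u w → Reach G X w v → Reach G X u v

Connected : ∀ {n} → Graph n → Set
Connected G = ∀ u v → Reach G ⊤ u v

Separates : ∀ {n} → Graph n → Subset n → Fin n → Fin n → Set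
Separates G T u v = u ∉ T × v ∉ T × ¬ Reach G (∁ T) u v

IsMinSep : ∀ {n} → Graph n → Fin n → Fin n → Subset n → Set
IsMinSep {n} G u v S =
  u ≢ v × ¬ Adj G u v × Separates G S u v ×
  (∀ (T : Subset n) → T ⊆ S → Separates G T u v → S ⊆ T)

MinimalSeparator : ∀ {n} → Graph n → Subset n → Set
MinimalSeparator {n} G S = Σ (Fin n) λ u → Σ (Fin n) λ v → IsMinSep G u v S

-- Nucleus of S w.r.t. the component of G - S containing a:
-- vertices of that component having a neighbour in S.
Nucleus : ∀ {n} → Graph n → Subset n → Fin n → Fin n → Set
Nucleus {n} G S a x = Reach G (∁ S) a x × Σ (Fin n) λ s → s ∈ S × Adj G x s

NbhdSub : ∀ {n} → Graph n → (Fin n → Set) → Fin n → Fin n → Set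
NbhdSub G X w w' = ∀ x → X x → Adj G w x → Adj G w' x

{-# OPTIONS --safe #-}

-- Fix an interval model and write x ≺ y when the interval of x ends before that of y
-- starts. Nonadjacent vertices are ≺-comparable, so a connected set of vertices lies
-- wholly on one side of every vertex it cannot reach, and distinct components of H − S
-- are ≺-comparable as wholes. Minimality makes the components of the two separated
-- vertices full (every s ∈ S has a neighbour in each); a vertex of S with neighbours in
-- two components would properly contain the interval of any component between them, so
-- there is no third component and every component is full. Now let A lie left of B and
-- l s ≤ l s′, hence r s ≤ r s′ by properness. A vertex x ∈ A adjacent to s′ but not to s
-- would lie strictly right of s (as l s ≤ l s′ ≤ r x), which is impossible since s also
-- meets B; so N_A(s′) ⊆ N_A(s), and symmetrically N_B(s) ⊆ N_B(s′). Ordering S by left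
-- endpoint therefore works.

module Submission where

open import Defs
open import Data.Nat using (ℕ)
open import Data.Fin using (Fin; _≤_)
open import Data.Fin.Subset using (Subset; _∈_; _∉_; ∁)
open import Data.Product using (Σ; _×_)
open import Relation.Nullary using (¬_)
open import Relation.Binary.PropositionalEquality using (_≡_)
open import Function.Definitions using (Injective)

open import Level using (0ℓ)
open import Function using (_∘_)
import Data.Nat as ℕ
open import Data.Nat using (_<_)
open import Data.Nat.Properties using (≤-decTotalOrder; _≤?_; ≰⇒>; <⇒≤; n≮n; module ≤-Reasoning)
open import Data.Fin using (zero; suc)
open import Data.Fin.Properties using (_≟_)
open import Data.Fin.Subset using (_∩_; ⁅_⁆; _⊆_)
open import Data.Fin.Subset.Properties
  using (_∈?_; x∈∁p⇒x∉p; x∉p⇒x∈∁p; x∈p⇒x∉∁p; x∉∁p⇒x∈p; x∈p∩q⁺; x∈p∩q⁻; x∈⁅x⁆; x≢y⇒x∉⁅y⁆)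
import Data.Bool as Bool
open import Data.Product using (_,_; proj₁; proj₂; swap)
open import Data.Sum using (_⊎_; inj₁; inj₂)
open import Data.Empty using (⊥; ⊥-elim)
open import Data.List using (List; _∷_; length; lookup; filter; allFin)
import Data.List.Relation.Unary.All as All
import Data.List.Relation.Unary.Any as Any
open import Data.List.Relation.Unary.Any.Properties using (lookup-index)
open import Data.List.Relation.Unary.Unique.Propositional using (Unique)
open import Data.List.Relation.Unary.Unique.Propositional.Properties using (allFin⁺; filter⁺)
open import Data.List.Relation.Unary.AllPairs using (_∷_)
open import Data.List.Membership.Propositional using () renaming (_∈_ to _∈ₗ_)
open import Data.List.Membership.Propositional.Properties using (∈-filter⁺; ∈-filter⁻; ∈-lookup; ∈-allFin)
open import Data.List.Relation.Binary.Permutation.Propositional using (_↭_; ↭-sym; ↭⇒↭ₛ)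
open import Data.List.Relation.Binary.Permutation.Propositional.Properties using (∈-resp-↭)
import Data.List.Relation.Binary.Permutation.Setoid.Properties as Permutationₛ
open import Relation.Nullary using (yes; no)
open import Relation.Nullary.Decidable using (decidable-stable)
open import Relation.Nullary.Negation using (¬¬-map)
open import Relation.Binary.Bundles using (DecTotalOrder)
open import Relation.Binary.Properties.DecTotalOrder ≤-decTotalOrder using (≥-decTotalOrder)
import Relation.Binary.Construct.On as On
open import Relation.Binary.PropositionalEquality using (_≢_; refl; cong; subst; setoid)
import Relation.Binary.PropositionalEquality as ≡

lookup-injective : ∀ {a} {A : Set a} {xs : List A} → Unique xs → Injective _≡_ _≡_ (lookup xs)
lookup-injective (_ ∷ _)         {zero}  {zero}  _  = refl
lookup-injective (x∉xs ∷ _)      {zero}  {suc j} eq = ⊥-elim (All.lookup x∉xs (∈-lookup j) eq)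
lookup-injective (x∉xs ∷ _)      {suc i} {zero}  eq = ⊥-elim (All.lookup x∉xs (∈-lookup i) (≡.sym eq))
lookup-injective (_ ∷ xs-unique) {suc i} {suc j} eq = cong suc (lookup-injective xs-unique eq)

module _ {c ℓ₁ ℓ₂} (O : DecTotalOrder c ℓ₁ ℓ₂) where
  open DecTotalOrder O using () renaming (Carrier to A; _≤_ to _≼_)

  sortedEnumeration : ∀ {n p} (key : Fin n → A) (S : Subset n) (P : Fin n → Fin n → Set p) →
    (∀ {s s′} → s ∈ S → s′ ∈ S → key s ≼ key s′ → P s s′) →
    Σ ℕ λ m → Σ (Fin m → Fin n) λ σ →
      Injective _≡_ _≡_ σ ×
      (∀ x → (x ∈ S → Σ (Fin m) λ i → σ i ≡ x) × (Σ (Fin m) (λ i → σ i ≡ x) → x ∈ S)) ×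
      (∀ i j → i ≤ j → P (σ i) (σ j))
  sortedEnumeration {n} key S P sorted⇒P =
    length ys , lookup ys , lookup-injective ys-unique , image ,
    λ i j i≤j → sorted⇒P (∈S i) (∈S j) (lookup-sorted i≤j)
    where
    Oₖ : DecTotalOrder 0ℓ ℓ₁ ℓ₂
    Oₖ = On.decTotalOrder O key
    open import Data.List.Sort Oₖ using (sort; sort-↭; sort-↗)
    open import Data.List.Relation.Unary.Sorted.TotalOrder.Properties using (lookup-mono-≤)

    xs ys : List (Fin n)
    xs = filter (_∈? S) (allFin n)
    ys = sort xs

    ys↭xs : ys ↭ xs
    ys↭xs = sort-↭ xs

    ys-unique : Unique ys
    ys-unique = Permutationₛ.Unique-resp-↭ (setoid (Fin n)) (↭⇒↭ₛ (↭-sym ys↭xs)) (filter⁺ (_∈? S) (allFin⁺ n))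

    ∈ys : ∀ {x} → x ∈ S → x ∈ₗ ys
    ∈ys x∈S = ∈-resp-↭ (↭-sym ys↭xs) (∈-filter⁺ (_∈? S) (∈-allFin _) x∈S)

    ∈S : ∀ i → lookup ys i ∈ S
    ∈S i = proj₂ (∈-filter⁻ (_∈? S) {xs = allFin n} (∈-resp-↭ ys↭xs (∈-lookup i)))

    image : ∀ x → (x ∈ S → Σ (Fin (length ys)) λ i → lookup ys i ≡ x) ×
                  (Σ (Fin (length ys)) (λ i → lookup ys i ≡ x) → x ∈ S)
    image x = (λ x∈S → Any.index (∈ys x∈S) , ≡.sym (lookup-index (∈ys x∈S)))
            , λ { (i , refl) → ∈S i }

    lookup-sorted : ∀ {i j} → i ≤ j → key (lookup ys i) ≼ key (lookup ys j)
    lookup-sorted = lookup-mono-≤ (DecTotalOrder.totalOrder Oₖ) (sort-↗ xs)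

module _ {n} (G : Graph n) where

  Adj-sym : ∀ {u v} → Adj G u v → Adj G v u
  Adj-sym {u} {v} u~v = ≡.trans (Graph.sym G v u) u~v

  Adj⇒≢ : ∀ {u v} → Adj G u v → u ≢ v
  Adj⇒≢ {u} u~u refl with ≡.trans (≡.sym u~u) (irrefl G u)
  ... | ()

  Adj-stable : ∀ {u v} → ¬ ¬ Adj G u v → Adj G u v
  Adj-stable {u} {v} = decidable-stable (adj G u v Bool.≟ Bool.true)

  module _ {X : Subset n} where

    Reach-source : ∀ {p q} → Reach G X p q → p ∈ X
    Reach-source (here p∈X)     = p∈X
    Reach-source (step p∈X _ _) = p∈X

    Reach-target : ∀ {p q} → Reach G X p q → q ∈ X
    Reach-target (here q∈X)     = q∈X
    Reach-target (step _ _ w↝q) = Reach-target w↝q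

    Reach-trans : ∀ {p q w} → Reach G X p q → Reach G X q w → Reach G X p w
    Reach-trans (here _)           q↝w = q↝w
    Reach-trans (step p∈X p~v v↝q) q↝w = step p∈X p~v (Reach-trans v↝q q↝w)

    Reach-sym : ∀ {p q} → Reach G X p q → Reach G X q p
    Reach-sym (here p∈X)         = here p∈X
    Reach-sym (step p∈X p~w w↝q) =
      Reach-trans (Reach-sym w↝q) (step (Reach-source w↝q) (Adj-sym p~w) (here p∈X))

  Reach-exit : ∀ {X Y p q} → Reach G Y p q → p ∈ X → ¬ Reach G X p q →
    Σ (Fin n) λ w → Reach G X p w × Σ (Fin n) λ s → s ∈ Y × s ∉ X × Adj G w s
  Reach-exit (here _) p∈X p↛q = ⊥-elim (p↛q (here p∈X))
  Reach-exit {X} (step {w = w} _ p~w w↝q) p∈X p↛q with w ∈? X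
  ... | no w∉X  = _ , here p∈X , w , Reach-source w↝q , w∉X , p~w
  ... | yes w∈X with Reach-exit w↝q w∈X (p↛q ∘ step p∈X p~w)
  ...   | w′ , w↝w′ , rest = w′ , step p∈X p~w w↝w′ , rest

  IsMinSep-sym : ∀ {u v S} → IsMinSep G u v S → IsMinSep G v u S
  IsMinSep-sym (u≢v , u≁v , (u∉S , v∉S , u↛v) , minimal) =
      u≢v ∘ ≡.sym , u≁v ∘ Adj-sym , (v∉S , u∉S , u↛v ∘ Reach-sym)
    , λ T T⊆S (v∉T , u∉T , v↛u) → minimal T T⊆S (u∉T , v∉T , v↛u ∘ Reach-sym)

  -- Double negation: minimality of S yields fullness only by contradiction, and
  -- fullness is only ever used to refute something or to prove decidable adjacency.
  FullComponent : Subset n → Fin n → Set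
  FullComponent S c = ∀ {s} → s ∈ S → ¬ ¬ (Σ (Fin n) λ x → Reach G (∁ S) c x × Adj G x s)

  FullComponent-resp : ∀ {S c c′} → Reach G (∁ S) c c′ → FullComponent S c → FullComponent S c′
  FullComponent-resp c↝c′ c-full s∈S no-nbr =
    c-full s∈S λ (x , c↝x , x~s) → no-nbr (x , Reach-trans (Reach-sym c↝c′) c↝x , x~s)

  x∈p∧x∉p∩∁⁅y⁆⇒x≡y : ∀ {p : Subset n} {x y} → x ∈ p → x ∉ p ∩ ∁ ⁅ y ⁆ → x ≡ y
  x∈p∧x∉p∩∁⁅y⁆⇒x≡y {x = x} {y} x∈p x∉ with x ≟ y
  ... | yes x≡y = x≡y
  ... | no  x≢y = ⊥-elim (x∉ (x∈p∩q⁺ (x∈p , x∉p⇒x∈∁p (x≢y⇒x∉⁅y⁆ x≢y))))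

  -- If s had no neighbour in the component of u, then S − s would still separate u from v.
  minimal⇒full : ∀ {u v S} → IsMinSep G u v S → FullComponent S u
  minimal⇒full {u} {v} {S} (_ , _ , (u∉S , v∉S , u↛v) , minimal) {s} s∈S no-nbr =
    x∈∁p⇒x∉p (proj₂ (x∈p∩q⁻ S _ s∈T)) (x∈⁅x⁆ s)
    where
    T : Subset n
    T = S ∩ ∁ ⁅ s ⁆

    T⊆S : T ⊆ S
    T⊆S = proj₁ ∘ x∈p∩q⁻ S _

    T-separates : ¬ Reach G (∁ T) u v
    T-separates u↝v with Reach-exit u↝v (x∉p⇒x∈∁p u∉S) u↛v
    ... | w , u↝w , s′ , s′∈∁T , s′∉∁S , w~s′ =
      no-nbr (w , u↝w , subst (Adj G w) (x∈p∧x∉p∩∁⁅y⁆⇒x≡y (x∉∁p⇒x∈p s′∉∁S) (x∈∁p⇒x∉p s′∈∁T)) w~s′)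

    s∈T : s ∈ T
    s∈T = minimal T T⊆S (u∉S ∘ T⊆S , v∉S ∘ T⊆S , T-separates) s∈S

  module ProperIntervalModel
    (l r : Fin n → ℕ)
    (l≤r : ∀ v → l v ℕ.≤ r v)
    (intersect : ∀ u v → u ≢ v →
       (Adj G u v → (l u ℕ.≤ r v × l v ℕ.≤ r u)) ×
       ((l u ℕ.≤ r v × l v ℕ.≤ r u) → Adj G u v))
    (proper : ∀ u v → ¬ ProperlyContains l r u v)
    where

    open ≤-Reasoning

    infix 4 _≺_
    _≺_ : Fin n → Fin n → Set
    x ≺ y = r x < l y

    adj⇒l≤r : ∀ {u v} → Adj G u v → l u ℕ.≤ r v
    adj⇒l≤r {u} {v} u~v = proj₁ (proj₁ (intersect u v (Adj⇒≢ u~v)) u~v)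

    ≢∧≁⇒≺⊎≻ : ∀ {u v} → u ≢ v → ¬ Adj G u v → u ≺ v ⊎ v ≺ u
    ≢∧≁⇒≺⊎≻ {u} {v} u≢v u≁v with l v ≤? r u | l u ≤? r v
    ... | yes lv≤ru | yes lu≤rv = ⊥-elim (u≁v (proj₂ (intersect u v u≢v) (lu≤rv , lv≤ru)))
    ... | no  lv≰ru | _         = inj₁ (≰⇒> lv≰ru)
    ... | yes _     | no  lu≰rv = inj₂ (≰⇒> lu≰rv)

    l-mono⇒r-mono : ∀ {s t} → l s ℕ.≤ l t → r s ℕ.≤ r t
    l-mono⇒r-mono {s} {t} ls≤lt with r s ≤? r t
    ... | yes rs≤rt = rs≤rt
    ... | no  rs≰rt = ⊥-elim (proper s t (ls≤lt , <⇒≤ (≰⇒> rs≰rt) , inj₂ (≰⇒> rs≰rt)))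

    -- Otherwise the interval of s would properly contain that of w.
    no-straddle : ∀ {s x y w} → Adj G x s → Adj G y s → x ≺ w → w ≺ y → ⊥
    no-straddle {s} {x} {y} {w} x~s y~s x≺w w≺y = proper s w
      ( <⇒≤ ls<lw , <⇒≤ rw<rs , inj₁ ls<lw )
      where
      ls<lw : l s < l w
      ls<lw = begin-strict l s ≤⟨ adj⇒l≤r (Adj-sym x~s) ⟩ r x <⟨ x≺w ⟩ l w ∎
      rw<rs : r w < r s
      rw<rs = begin-strict r w <⟨ w≺y ⟩ l y ≤⟨ adj⇒l≤r y~s ⟩ r s ∎

    module _ {X : Subset n} where

      unreachable⇒≺⊎≻ : ∀ {p x y} → Reach G X p x → y ∈ X → ¬ Reach G X p y → x ≺ y ⊎ y ≺ x
      unreachable⇒≺⊎≻ p↝x y∈X p↛y = ≢∧≁⇒≺⊎≻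
        (λ { refl → p↛y p↝x })
        (λ x~y → p↛y (Reach-trans p↝x (step (Reach-target p↝x) x~y (here y∈X))))

      component-≺ : ∀ {p x y} → Reach G X p x → y ∈ X → ¬ Reach G X p y → p ≺ y → x ≺ y
      component-≺ (here _) _ _ p≺y = p≺y
      component-≺ {p} {y = y} (step {w = w} p∈X p~w w↝x) y∈X p↛y p≺y =
        component-≺ w↝x y∈X (p↛y ∘ step p∈X p~w) w≺y
        where
        w≺y : w ≺ y
        w≺y with unreachable⇒≺⊎≻ (step p∈X p~w (here (Reach-source w↝x))) y∈X p↛y
        ... | inj₁ w≺y = w≺y
        ... | inj₂ y≺w = ⊥-elim (n≮n (r y) (begin-strict
              r y <⟨ y≺w ⟩ l w ≤⟨ adj⇒l≤r (Adj-sym p~w) ⟩ r p <⟨ p≺y ⟩ l y ≤⟨ l≤r y ⟩ r y ∎))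

      ≺-component : ∀ {p x y} → Reach G X p x → y ∈ X → ¬ Reach G X p y → y ≺ p → y ≺ x
      ≺-component {p} {y = y} p↝x y∈X p↛y y≺p with unreachable⇒≺⊎≻ p↝x y∈X p↛y
      ... | inj₂ y≺x = y≺x
      ... | inj₁ x≺y = ⊥-elim (n≮n (r y) (begin-strict
            r y <⟨ y≺p ⟩ l p ≤⟨ l≤r p ⟩ r p <⟨ p≺y ⟩ l y ≤⟨ l≤r y ⟩ r y ∎))
        where
        p≺y : p ≺ y
        p≺y = component-≺ (Reach-sym p↝x) y∈X (p↛y ∘ Reach-trans p↝x) x≺y

      component-≺-component : ∀ {a b x y} → Reach G X a x → Reach G X b y → ¬ Reach G X a b → a ≺ b → x ≺ y
      component-≺-component a↝x b↝y a↛b a≺b =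
        ≺-component b↝y (Reach-target a↝x) (λ b↝x → a↛b (Reach-trans a↝x (Reach-sym b↝x)))
          (component-≺ a↝x (Reach-source b↝y) a↛b a≺b)

      left-nbhd-antitone : ∀ {a b x y s s′} → Reach G X a x → Reach G X b y → ¬ Reach G X a b → a ≺ b →
        s ∉ X → Adj G y s → l s ℕ.≤ l s′ → Adj G s′ x → Adj G s x
      left-nbhd-antitone {x = x} {y} {s} {s′} a↝x b↝y a↛b a≺b s∉X y~s ls≤ls′ s′~x =
        Adj-stable λ s≁x → apart⇒⊥ (≢∧≁⇒≺⊎≻ (λ { refl → s∉X (Reach-target a↝x) }) s≁x)
        where
        apart⇒⊥ : s ≺ x ⊎ x ≺ s → ⊥
        apart⇒⊥ (inj₁ s≺x) = n≮n (r s) (begin-strict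
          r s <⟨ s≺x ⟩ l x ≤⟨ l≤r x ⟩ r x <⟨ component-≺-component a↝x b↝y a↛b a≺b ⟩
          l y ≤⟨ adj⇒l≤r y~s ⟩ r s ∎)
        apart⇒⊥ (inj₂ x≺s) = n≮n (r x) (begin-strict
          r x <⟨ x≺s ⟩ l s ≤⟨ ls≤ls′ ⟩ l s′ ≤⟨ adj⇒l≤r s′~x ⟩ r x ∎)

      right-nbhd-monotone : ∀ {a b x y s s′} → Reach G X a x → Reach G X b y → ¬ Reach G X a b → a ≺ b →
        s′ ∉ X → Adj G x s′ → l s ℕ.≤ l s′ → Adj G s y → Adj G s′ y
      right-nbhd-monotone {x = x} {y} {s} {s′} a↝x b↝y a↛b a≺b s′∉X x~s′ ls≤ls′ s~y =
        Adj-stable λ s′≁y → apart⇒⊥ (≢∧≁⇒≺⊎≻ (λ { refl → s′∉X (Reach-target b↝y) }) s′≁y)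
        where
        apart⇒⊥ : s′ ≺ y ⊎ y ≺ s′ → ⊥
        apart⇒⊥ (inj₁ s′≺y) = n≮n (r s′) (begin-strict
          r s′ <⟨ s′≺y ⟩ l y ≤⟨ adj⇒l≤r (Adj-sym s~y) ⟩ r s ≤⟨ l-mono⇒r-mono ls≤ls′ ⟩ r s′ ∎)
        apart⇒⊥ (inj₂ y≺s′) = n≮n (l s′) (begin-strict
          l s′ ≤⟨ adj⇒l≤r (Adj-sym x~s′) ⟩ r x <⟨ component-≺-component a↝x b↝y a↛b a≺b ⟩
          l y ≤⟨ l≤r y ⟩ r y <⟨ y≺s′ ⟩ l s′ ∎)

    module _ (S : Subset n) where

      private
        _↝_ : Fin n → Fin n → Set
        _↝_ = Reach G (∁ S)

      -- Leaving the component of c towards u gives an s ∈ S with neighbours in the components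
      -- of c, u and v; wherever c lies, s straddles one of u, c and v.
      no-third-component≺ : Connected G → ∀ {u v c} → u ∈ ∁ S → v ∈ ∁ S → ¬ u ↝ v → u ≺ v →
        FullComponent S u → FullComponent S v → c ∈ ∁ S → ¬ u ↝ c → ¬ v ↝ c → ⊥
      no-third-component≺ connected {u} {v} {c} u∈ v∈ u↛v u≺v u-full v-full c∈ u↛c v↛c
        with Reach-exit (connected c u) c∈ (u↛c ∘ Reach-sym)
      ... | w , c↝w , s , _ , s∉∁S , w~s =
        u-full s∈S λ (x , u↝x , x~s) → v-full s∈S λ (y , v↝y , y~s) →
          straddled x u↝x x~s y v↝y y~s (unreachable⇒≺⊎≻ (here u∈) c∈ u↛c)
        where
        s∈S : s ∈ S
        s∈S = x∉∁p⇒x∈p s∉∁S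

        straddled : ∀ x → u ↝ x → Adj G x s → ∀ y → v ↝ y → Adj G y s → u ≺ c ⊎ c ≺ u → ⊥
        straddled _ _ _ y v↝y y~s (inj₂ c≺u) = no-straddle w~s y~s
          (component-≺ c↝w u∈ (u↛c ∘ Reach-sym) c≺u)
          (≺-component v↝y u∈ (u↛v ∘ Reach-sym) u≺v)
        straddled x u↝x x~s y v↝y y~s (inj₁ u≺c) with unreachable⇒≺⊎≻ (here v∈) c∈ v↛c
        ... | inj₂ c≺v = no-straddle x~s y~s
          (component-≺ u↝x c∈ u↛c u≺c)
          (≺-component v↝y c∈ v↛c c≺v)
        ... | inj₁ v≺c = no-straddle x~s w~s
          (component-≺ u↝x v∈ u↛v u≺v)
          (≺-component c↝w v∈ (v↛c ∘ Reach-sym) v≺c)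

      no-third-component : Connected G → ∀ {u v c} → u ∈ ∁ S → v ∈ ∁ S → ¬ u ↝ v →
        FullComponent S u → FullComponent S v → c ∈ ∁ S → ¬ u ↝ c → ¬ v ↝ c → ⊥
      no-third-component connected u∈ v∈ u↛v u-full v-full c∈ u↛c v↛c
        with unreachable⇒≺⊎≻ (here u∈) v∈ u↛v
      ... | inj₁ u≺v = no-third-component≺ connected u∈ v∈ u↛v u≺v u-full v-full c∈ u↛c v↛c
      ... | inj₂ v≺u = no-third-component≺ connected v∈ u∈ (u↛v ∘ Reach-sym) v≺u v-full u-full c∈ v↛c u↛c

      every-component-full : Connected G → ∀ {u v c} → IsMinSep G u v S → c ∉ S → FullComponent S c
      every-component-full connected {u} {v} minSep@(_ , _ , (u∉S , v∉S , u↛v) , _) c∉S s∈S no-nbr =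
        no-third-component connected (x∉p⇒x∈∁p u∉S) (x∉p⇒x∈∁p v∉S) u↛v u-full v-full (x∉p⇒x∈∁p c∉S)
          (λ u↝c → FullComponent-resp u↝c u-full s∈S no-nbr)
          (λ v↝c → FullComponent-resp v↝c v-full s∈S no-nbr)
        where
        u-full : FullComponent S u
        u-full = minimal⇒full minSep
        v-full : FullComponent S v
        v-full = minimal⇒full (IsMinSep-sym minSep)

      NestedBefore : Fin n → Fin n → Fin n → Fin n → Set
      NestedBefore a b s s′ = NbhdSub G (Nucleus G S a) s′ s × NbhdSub G (Nucleus G S b) s s′

      nested-neighbourhoods : ∀ {a b s s′} → FullComponent S a → FullComponent S b → ¬ a ↝ b → a ≺ b →
        s ∈ S → s′ ∈ S → l s ℕ.≤ l s′ → NestedBefore a b s s′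
      nested-neighbourhoods a-full b-full a↛b a≺b s∈S s′∈S ls≤ls′ =
          (λ x (a↝x , _) s′~x → Adj-stable (¬¬-map
            (λ (y , b↝y , y~s) → left-nbhd-antitone a↝x b↝y a↛b a≺b (x∈p⇒x∉∁p s∈S) y~s ls≤ls′ s′~x)
            (b-full s∈S)))
        , (λ y (b↝y , _) s~y → Adj-stable (¬¬-map
            (λ (x , a↝x , x~s′) → right-nbhd-monotone a↝x b↝y a↛b a≺b (x∈p⇒x∉∁p s′∈S) x~s′ ls≤ls′ s~y)
            (a-full s′∈S)))

      -- Sort S by left endpoint: ascending if the component of a lies left of that of b,
      -- descending otherwise.
      nested-ordering : ∀ {a b} → FullComponent S a → FullComponent S b → a ∉ S → b ∉ S → ¬ a ↝ b →
        Σ ℕ λ m → Σ (Fin m → Fin n) λ σ →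
          Injective _≡_ _≡_ σ ×
          (∀ x → (x ∈ S → Σ (Fin m) λ i → σ i ≡ x) × (Σ (Fin m) (λ i → σ i ≡ x) → x ∈ S)) ×
          (∀ i j → i ≤ j → NestedBefore a b (σ i) (σ j))
      nested-ordering {a} {b} a-full b-full a∉S b∉S a↛b
        with unreachable⇒≺⊎≻ (here (x∉p⇒x∈∁p a∉S)) (x∉p⇒x∈∁p b∉S) a↛b
      ... | inj₁ a≺b = sortedEnumeration ≤-decTotalOrder l S (NestedBefore a b)
            (nested-neighbourhoods a-full b-full a↛b a≺b)
      ... | inj₂ b≺a = sortedEnumeration ≥-decTotalOrder l S (NestedBefore a b)
            (λ s∈S s′∈S ls′≤ls →
              swap (nested-neighbourhoods b-full a-full (a↛b ∘ Reach-sym) b≺a s′∈S s∈S ls′≤ls))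

mainTheorem13 : ∀ {n} (G : Graph n) → Connected G → ProperInterval G →
    (S : Subset n) → MinimalSeparator G S →
    (a b : Fin n) → a ∉ S → b ∉ S → ¬ Reach G (∁ S) a b →
    Σ ℕ λ m → Σ (Fin m → Fin n) λ σ →
      Injective _≡_ _≡_ σ ×
      (∀ x → (x ∈ S → Σ (Fin m) λ i → σ i ≡ x) × (Σ (Fin m) (λ i → σ i ≡ x) → x ∈ S)) ×
      (∀ i j → i ≤ j →
        NbhdSub G (Nucleus G S a) (σ j) (σ i) × NbhdSub G (Nucleus G S b) (σ i) (σ j))
mainTheorem13 G connected (l , r , l≤r , intersect , proper) S (_ , _ , minSep) a b a∉S b∉S a↛b =
  nested-ordering S (every-component-full S connected minSep a∉S)
                    (every-component-full S connected minSep b∉S) a∉S b∉S a↛b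
  where open ProperIntervalModel G l r l≤r intersect proper
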